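{- Let $D$, $H$, $f$, $D'$ be as in the standing assumptions, let $\mathcal{F}$ be a family of at most $\gamma n$ vertex-disjoint absorbing $4$-paths in $D'$ such that each vertex pair $(u,v)$ is absorbed by at least $\gamma^2 n$ members of $\mathcal{F}$, and let $s$ be any positive integer. Let $\mathcal{F}=\mathcal{F}_1\cup\cdots\cup\mathcal{F}_s$ with $\mathcal{F}_i=\{F_{i,1},\dots,F_{i,l_i}\}$ for every $i\in[s]$. Then for any $i\in[s]$ there exists a directed path $L_i$ in $D'$ of the form $L_i=F_{i,1}\circ P_{i,1}\circ F_{i,2}\circ\cdots\circ F_{i,l_i-1}\circ P_{i,l_i-1}\circ F_{i,l_i}$, where each path $P_{i,j}$ has length at most $3$, and the paths $L_1,\dots,L_s$ are vertex-disjoint.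
   Context: Standing assumptions: $H$ is a digraph with $k$ arcs and $\min_x(d^+(x)+d^-(x))\geq1$. Constants satisfy $1/C<\alpha,\beta,\gamma\ll\varepsilon'\ll\varepsilon_1\ll\varepsilon<1$ ($x\ll y$: $x$ sufficiently small relative to $y$). $D$ is a digraph on $n\geq Ck$ vertices with $\min\{\delta^+(D),\delta^-(D)\}\geq n/2+k$, and $D$ is stable: there are no vertex sets $U_1,U_2$ (not necessarily disjoint) with $|U_i|\geq(1/2-\varepsilon')n$ and at most $(\varepsilon' n)^2$ arcs from $U_1$ to $U_2$. $f:V(H)\to V(D)$ is injective and $D'=D-f(V(H))$. A $4$-path $z_1z_2z_3z_4$ absorbs $(u,v)$ if $z_2u,vz_3$ are arcs. For paths $P=a\cdots b$ and $Q=b\cdots d$ with $V(P)\cap V(Q)=\{b\}$, $P\circ Q$ is their concatenation; in the displayed form, $P_{i,j}$ goes from the terminal vertex of $F_{i,j}$ to the initial vertex of $F_{i,j+1}$. -}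

module Defs where

open import Data.Nat using (ℕ; zero; suc)
open import Data.Bool using (Bool; true; false; _∧_; T)
open import Data.Fin using (Fin; zero; suc)
open import Data.Fin.Subset using (Subset; ∣_∣)
open import Data.Vec using (Vec; lookup; toList)
open import Data.List using (List; []; _∷_; _++_; length; filterᵇ; allFin; concatMap; map)
open import Data.Nat.ListAction using (sum)
open import Data.List.Membership.Propositional using (_∈_)
open import Data.List.Relation.Unary.All using (All)
open import Data.List.Relation.Unary.Unique.Propositional using (Unique)
open import Data.Integer using (+_)
open import Data.Rational using (ℚ; _/_; _≤_; _-_; _*_; ½)
open import Data.Product using (_×_; _,_)
open import Data.Unit using (⊤)
open import Relation.Binary.PropositionalEquality using (_≡_)
open import Relation.Nullary using (¬_)

ℕq : ℕ → ℚ
ℕq n = + n / 1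

Adj : ℕ → Set
Adj n = Fin n → Fin n → Bool

-- no loops (digraphs are simple: no loops, no parallel arcs)
Loopless : ∀ {n} → Adj n → Set
Loopless {n} A = (x : Fin n) → A x x ≡ false

outdeg : ∀ {n} → Adj n → Fin n → ℕ
outdeg {n} A x = length (filterᵇ (λ y → A x y) (allFin n))

indeg : ∀ {n} → Adj n → Fin n → ℕ
indeg {n} A x = length (filterᵇ (λ y → A y x) (allFin n))

arcs : ∀ {n} → Adj n → ℕ
arcs {n} A = sum (map (outdeg A) (allFin n))

arcsFromTo : ∀ {n} → Adj n → Subset n → Subset n → ℕ
arcsFromTo {n} A U₁ U₂ =
  length (concatMap (λ x → filterᵇ (λ y → lookup U₁ x ∧ lookup U₂ y ∧ A x y) (allFin n)) (allFin n))

Stable : ∀ {n} → Adj n → ℚ → Set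
Stable {n} A ε' = (U₁ U₂ : Subset n) →
  (½ - ε') * ℕq n ≤ ℕq ∣ U₁ ∣ → (½ - ε') * ℕq n ≤ ℕq ∣ U₂ ∣ →
  ¬ (ℕq (arcsFromTo A U₁ U₂) ≤ (ε' * ℕq n) * (ε' * ℕq n))

-- vertex v lies in D' = D - f(V(H))
InD' : ∀ {h n} → (Fin h → Fin n) → Fin n → Set
InD' f v = ∀ x → ¬ (f x ≡ v)

ArcsAlong : ∀ {n} → Adj n → List (Fin n) → Set
ArcsAlong A [] = ⊤
ArcsAlong A (x ∷ []) = ⊤
ArcsAlong A (x ∷ y ∷ xs) = T (A x y) × ArcsAlong A (y ∷ xs)

IsPathInD' : ∀ {h n} → Adj n → (Fin h → Fin n) → List (Fin n) → Set
IsPathInD' A f xs = Unique xs × All (InD' f) xs × ArcsAlong A xs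

FourPath : ℕ → Set
FourPath n = Vec (Fin n) 4

-- z₁z₂z₃z₄ absorbs (u,v) iff z₂u and vz₃ are arcs
absorbs : ∀ {n} → Adj n → FourPath n → Fin n → Fin n → Bool
absorbs A z u v = A (lookup z (suc zero)) u ∧ A v (lookup z (suc (suc zero)))

absorbCount : ∀ {n} → Adj n → List (FourPath n) → Fin n → Fin n → ℕ
absorbCount A 𝓕 u v = length (filterᵇ (λ z → absorbs A z u v) 𝓕)

VDisjoint : ∀ {n} → List (Fin n) → List (Fin n) → Set
VDisjoint xs ys = ∀ a → a ∈ xs → ¬ (a ∈ ys)

-- L = F₁ ∘ P₁ ∘ F₂ ∘ ⋯ ∘ P_{l-1} ∘ F_l as a vertex sequence, where each
-- connecting path P_j is given by its list of interior vertices
-- (P_j runs from the last vertex of F_j to the first vertex of F_{j+1}).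
chain : ∀ {n} → List (FourPath n) → List (List (Fin n)) → List (Fin n)
chain [] ps = []
chain (F ∷ []) ps = toList F
chain (F ∷ F′ ∷ Fs) [] = toList F ++ chain (F′ ∷ Fs) []
chain (F ∷ F′ ∷ Fs) (p ∷ ps) = toList F ++ p ++ chain (F′ ∷ Fs) ps

{-# OPTIONS --safe #-}
-- Consecutive absorbers F, F′ of a part are joined greedily by a path z₄ x y w₁ from the last
-- vertex of F to the first vertex of F′ through unused vertices. At every step at most
-- 2k + 6|𝓕| vertices are forbidden: f(V(H)) (at most 2k, as H has no isolated vertex), the
-- 4|𝓕| vertices of the family and at most 2|𝓕| earlier connector vertices. For γ ≤ ε'/7 we
-- have k + 6|𝓕| ≤ ε'n, so the minimum semidegree n/2 + k leaves at least (1/2 − ε')n admissible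
-- out-neighbours of z₄ and in-neighbours of w₁, and by stability some arc x → y joins the two
-- sets.
module Submission where

open import Defs
open import Data.Nat using (ℕ; _≤_; _+_; _*_; _∸_; suc)
open import Data.Bool using (T)
open import Data.Fin using (Fin)
open import Data.Vec using (toList)
open import Data.List using (List; length; concat)
open import Data.List.Relation.Unary.All using (All)
open import Data.List.Relation.Unary.AllPairs using (AllPairs)
open import Data.Rational using (ℚ; 0ℚ; 1ℚ) renaming (_≤_ to _≤ℚ_; _<_ to _<ℚ_; _*_ to _*ℚ_)
open import Data.Vec.Functional using () renaming (toList to funToList)
open import Data.Product using (Σ; _×_; ∃)
open import Function.Definitions using (Injective)
open import Relation.Binary.PropositionalEquality using (_≡_; _≢_)

open import Algebra.Bundles using (CommutativeMonoid)
import Algebra.Properties.CommutativeSemigroup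
open import Data.Nat.Properties using (+-0-commutativeMonoid)
open import Algebra.Properties.CommutativeMonoid.Sum +-0-commutativeMonoid
  using (∑-comm; ∑-distrib-+; sum-cong-≗; sum-syntax)
open import Data.Bool using (Bool; true; false; if_then_else_)
open import Data.Bool.Properties using (T-≡; T-∧)
open import Data.Empty using (⊥-elim)
open import Data.Fin using (zero; suc)
open import Data.Fin.Properties using (∀-cons)
open import Data.Fin.Subset using (Subset; ∣_∣; _∪_; _∩_; ∁; ⁅_⁆; ⋃; _⊆_; inside; outside)
  renaming (_∈_ to _∈ₛ_)
open import Data.Fin.Subset.Properties
  using (_∈?_; ∣⊥∣≡0; ∣⁅x⁆∣≡1; ∣p∣≤∣x∷p∣; p⊆q⇒∣p∣≤∣q∣; x∈⁅x⁆; x∈p∪q⁺; x∈p∩q⁺; x∈p∩q⁻; x∉p⇒x∈∁p; x∈∁p⇒x∉p)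
import Data.Integer as ℤ
import Data.Integer.Properties as ℤ
import Data.Integer.Tactic.RingSolver as ℤ
open import Data.List using ([]; _∷_; _++_; map; concatMap; filterᵇ; allFin; tabulate)
open import Data.List.Properties
  using (length-++; length-++-≤ʳ; length-map; length-tabulate; map-tabulate; ++-assoc; ++-identityʳ; concatMap-++)
open import Data.List.Membership.Propositional using (_∈_; _∉_)
open import Data.List.Membership.Propositional.Properties
  using (∈-++⁺ˡ; ∈-++⁺ʳ; ∈-map⁺; ∈-map⁻; ∈-allFin; ∈-concat⁺′; ∈-concat⁻′; ∈-filter⁻; ∈-tabulate⁺)
open import Data.List.Relation.Binary.Disjoint.Propositional using (Disjoint)
open import Data.List.Relation.Binary.Permutation.Propositional
  using (_↭_; ↭-refl; ↭-reflexive; ↭-sym; ↭⇒↭ₛ; module PermutationReasoning)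
open import Data.List.Relation.Binary.Permutation.Propositional.Properties
  using (++⁺; ++⁺ˡ; shifts; ++-commutativeMonoid; All-resp-↭)
import Data.List.Relation.Binary.Permutation.Setoid.Properties as Permₛ
open import Data.List.Relation.Unary.All using ([]; _∷_)
import Data.List.Relation.Unary.All as All
import Data.List.Relation.Unary.All.Properties as All
import Data.List.Relation.Unary.AllPairs as AllPairs
import Data.List.Relation.Unary.AllPairs.Properties as AllPairs
open import Data.List.Relation.Unary.Any using (here; there)
open import Data.List.Relation.Unary.Unique.Propositional using (Unique; []; _∷_)
import Data.List.Relation.Unary.Unique.Propositional.Properties as Unique
open import Data.Nat using (zero; z≤n; s≤s)
open import Data.Nat.ListAction using () renaming (sum to sumˡ)
open import Data.Nat.Properties
  using (≤-refl; ≤-trans; ≤-reflexive; +-mono-≤; +-monoˡ-≤; +-monoʳ-≤; *-monoʳ-≤; +-suc; *-suc; *-distribˡ-+;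
         n≤1+n; m∸n≤m; suc-injective; m≤n⇒∃[o]m+o≡n; module ≤-Reasoning)
open import Data.Nat.Tactic.RingSolver using (solve-∀)
open import Data.Product using (Σ-syntax; ∃₂; _,_; proj₁; proj₂)
open import Data.Rational using (½; NonNegative; nonNegative; toℚᵘ) renaming (_+_ to _+ℚ_; _-_ to _-ℚ_; _/_ to _/ℚ_)
import Data.Rational.Properties as ℚ
open import Data.Rational.Solver using (module +-*-Solver)
import Data.Rational.Unnormalised as ℚᵘ
import Data.Rational.Unnormalised.Properties as ℚᵘ
open import Data.Sum using (inj₁; inj₂)
open import Data.Unit using (tt)
import Data.Vec as Vec
open import Data.Vec.Functional using () renaming (_∷_ to _∷ᶠ_)
open import Data.Vec.Properties using (lookup∘tabulate; []=⇒lookup; lookup⇒[]=)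
open import Function using (_∘_; id; Equivalence)
open import Relation.Binary.PropositionalEquality using (refl; sym; trans; subst; cong; cong₂; setoid)
open import Relation.Nullary using (yes; no)
open import Relation.Nullary.Decidable using (T?)

module _ {a} {X : Set a} where

  Unique-++⁻ : ∀ xs {ys : List X} → Unique (xs ++ ys) → Unique xs × Unique ys × Disjoint xs ys
  Unique-++⁻ [] u = [] , u , λ ()
  Unique-++⁻ (x ∷ xs) (x∉ ∷ u) with Unique-++⁻ xs u
  ... | uxs , uys , xs#ys = All.++⁻ˡ xs x∉ ∷ uxs , uys , x∷xs#ys
    where
    x∷xs#ys : Disjoint (x ∷ xs) _
    x∷xs#ys (here refl , v∈ys) = All.lookup x∉ (∈-++⁺ʳ xs v∈ys) refl
    x∷xs#ys (there v∈xs , v∈ys) = xs#ys (v∈xs , v∈ys)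

  ∈-concat-tabulate⁺ : ∀ {s} (W : Fin s → List X) i {v} → v ∈ W i → v ∈ concat (funToList W)
  ∈-concat-tabulate⁺ W i v∈Wᵢ = ∈-concat⁺′ v∈Wᵢ (∈-tabulate⁺ i)

  Unique-concat-tabulate⁻ : ∀ s (W : Fin s → List X) → Unique (concat (funToList W)) →
    (∀ i → Unique (W i)) × (∀ {i j} → i ≢ j → Disjoint (W i) (W j))
  Unique-concat-tabulate⁻ zero W u = (λ ()) , λ { {()} }
  Unique-concat-tabulate⁻ (suc s) W u with Unique-++⁻ (W zero) u
  ... | u₀ , uᵣ , W₀#Wᵣ with Unique-concat-tabulate⁻ s (W ∘ suc) uᵣ
  ... | uₛ , Wₛ#Wₛ = ∀-cons u₀ uₛ , W#W
    where
    W#W : ∀ {i j} → i ≢ j → Disjoint (W i) (W j)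
    W#W {zero} {zero} 0≢0 = ⊥-elim (0≢0 refl)
    W#W {zero} {suc j} _ (v∈W₀ , v∈Wⱼ) = W₀#Wᵣ (v∈W₀ , ∈-concat-tabulate⁺ (W ∘ suc) j v∈Wⱼ)
    W#W {suc i} {zero} _ (v∈Wᵢ , v∈W₀) = W₀#Wᵣ (v∈W₀ , ∈-concat-tabulate⁺ (W ∘ suc) i v∈Wᵢ)
    W#W {suc i} {suc j} i≢j = Wₛ#Wₛ (i≢j ∘ cong suc)

  length-concat-≤ : ∀ {c} {xss : List (List X)} → All (λ xs → length xs ≤ c) xss →
    length (concat xss) ≤ c * length xss
  length-concat-≤ [] = z≤n
  length-concat-≤ {c} {xs ∷ xss} (|xs|≤c ∷ |xss|≤c) = begin
    length (xs ++ concat xss)         ≡⟨ length-++ xs ⟩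
    length xs + length (concat xss)   ≤⟨ +-mono-≤ |xs|≤c (length-concat-≤ |xss|≤c) ⟩
    c + c * length xss                ≡⟨ *-suc c (length xss) ⟨
    c * suc (length xss)              ∎
    where open ≤-Reasoning

  *-length-++ : ∀ c (xs : List X) {ys} → c * length xs + c * length ys ≡ c * length (xs ++ ys)
  *-length-++ c xs {ys} = trans (sym (*-distribˡ-+ c (length xs) (length ys))) (cong (c *_) (sym (length-++ xs)))

∣p∪q∣≤∣p∣+∣q∣ : ∀ {n} (p q : Subset n) → ∣ p ∪ q ∣ ≤ ∣ p ∣ + ∣ q ∣
∣p∪q∣≤∣p∣+∣q∣ Vec.[] Vec.[] = z≤n
∣p∪q∣≤∣p∣+∣q∣ (inside Vec.∷ p) (y Vec.∷ q) =
  s≤s (≤-trans (∣p∪q∣≤∣p∣+∣q∣ p q) (+-monoʳ-≤ ∣ p ∣ (∣p∣≤∣x∷p∣ y q)))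
∣p∪q∣≤∣p∣+∣q∣ (outside Vec.∷ p) (inside Vec.∷ q) =
  ≤-trans (s≤s (∣p∪q∣≤∣p∣+∣q∣ p q)) (≤-reflexive (sym (+-suc ∣ p ∣ ∣ q ∣)))
∣p∪q∣≤∣p∣+∣q∣ (outside Vec.∷ p) (outside Vec.∷ q) = ∣p∪q∣≤∣p∣+∣q∣ p q

∣p∣≤∣p∩∁q∣+∣q∣ : ∀ {n} (p q : Subset n) → ∣ p ∣ ≤ ∣ p ∩ ∁ q ∣ + ∣ q ∣
∣p∣≤∣p∩∁q∣+∣q∣ p q = ≤-trans (p⊆q⇒∣p∣≤∣q∣ p⊆p∩∁q∪q) (∣p∪q∣≤∣p∣+∣q∣ (p ∩ ∁ q) q)
  where
  p⊆p∩∁q∪q : p ⊆ p ∩ ∁ q ∪ q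
  p⊆p∩∁q∪q {x} x∈p with x ∈? q
  ... | yes x∈q = x∈p∪q⁺ (inj₂ x∈q)
  ... | no x∉q = x∈p∪q⁺ (inj₁ (x∈p∩q⁺ (x∈p , x∉p⇒x∈∁p x∉q)))

fromList : ∀ {n} → List (Fin n) → Subset n
fromList xs = ⋃ (map ⁅_⁆ xs)

∣fromList∣≤length : ∀ {n} (xs : List (Fin n)) → ∣ fromList xs ∣ ≤ length xs
∣fromList∣≤length {n} [] = ≤-reflexive (∣⊥∣≡0 n)
∣fromList∣≤length (x ∷ xs) =
  ≤-trans (∣p∪q∣≤∣p∣+∣q∣ ⁅ x ⁆ (fromList xs)) (+-mono-≤ (≤-reflexive (∣⁅x⁆∣≡1 x)) (∣fromList∣≤length xs))

∈-fromList⁺ : ∀ {n} {x : Fin n} {xs} → x ∈ xs → x ∈ₛ fromList xs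
∈-fromList⁺ {x = x} (here refl) = x∈p∪q⁺ (inj₁ (x∈⁅x⁆ x))
∈-fromList⁺ (there x∈xs) = x∈p∪q⁺ (inj₂ (∈-fromList⁺ x∈xs))

length-filterᵇ-tabulate : ∀ {a} {X : Set a} {n} (g : X → Bool) (t : Fin n → X) →
  length (filterᵇ g (tabulate t)) ≡ ∣ Vec.tabulate (g ∘ t) ∣
length-filterᵇ-tabulate {n = zero} g t = refl
length-filterᵇ-tabulate {n = suc n} g t with g (t zero)
... | true = cong suc (length-filterᵇ-tabulate g (t ∘ suc))
... | false = length-filterᵇ-tabulate g (t ∘ suc)

∣tabulate∣≡∑ : ∀ {n} (g : Fin n → Bool) → ∣ Vec.tabulate g ∣ ≡ ∑[ i < n ] (if g i then 1 else 0)
∣tabulate∣≡∑ {zero} g = refl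
∣tabulate∣≡∑ {suc n} g with g zero
... | true = cong suc (∣tabulate∣≡∑ (g ∘ suc))
... | false = ∣tabulate∣≡∑ (g ∘ suc)

sum-tabulate : ∀ {n} (g : Fin n → ℕ) → sumˡ (tabulate g) ≡ ∑[ i < n ] g i
sum-tabulate {zero} g = refl
sum-tabulate {suc n} g = cong (g zero +_) (sum-tabulate (g ∘ suc))

n≤∑ : ∀ {n} (g : Fin n → ℕ) → (∀ i → 1 ≤ g i) → n ≤ ∑[ i < n ] g i
n≤∑ {zero} g 1≤g = z≤n
n≤∑ {suc n} g 1≤g = +-mono-≤ (1≤g zero) (n≤∑ (g ∘ suc) (1≤g ∘ suc))

length-filterᵇ-allFin : ∀ {n} (g : Fin n → Bool) →
  length (filterᵇ g (allFin n)) ≡ ∑[ i < n ] (if g i then 1 else 0)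
length-filterᵇ-allFin g = trans (length-filterᵇ-tabulate g id) (∣tabulate∣≡∑ g)

noIsolated⇒n≤arcs+arcs : ∀ {n} (A : Adj n) → (∀ x → 1 ≤ outdeg A x + indeg A x) → n ≤ arcs A + arcs A
noIsolated⇒n≤arcs+arcs {n} A deg≥1 = begin
  n                                          ≤⟨ n≤∑ _ deg≥1 ⟩
  ∑[ x < n ] (outdeg A x + indeg A x)        ≡⟨ ∑-distrib-+ (outdeg A) (indeg A) ⟩
  ∑[ x < n ] outdeg A x + ∑[ x < n ] indeg A x ≡⟨ cong₂ _+_ (sym arcs≡∑outdeg) ∑indeg≡arcs ⟩
  arcs A + arcs A                            ∎
  where
  open ≤-Reasoning
  arcs≡∑outdeg : arcs A ≡ ∑[ x < n ] outdeg A x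
  arcs≡∑outdeg = trans (cong sumˡ (map-tabulate id (outdeg A))) (sum-tabulate (outdeg A))
  ∑indeg≡arcs : ∑[ x < n ] indeg A x ≡ arcs A
  ∑indeg≡arcs = begin-equality
    ∑[ x < n ] indeg A x                                  ≡⟨ sum-cong-≗ (λ x → length-filterᵇ-allFin (λ y → A y x)) ⟩
    ∑[ x < n ] ∑[ y < n ] (if A y x then 1 else 0)        ≡⟨ ∑-comm (λ x y → if A y x then 1 else 0) ⟩
    ∑[ y < n ] ∑[ x < n ] (if A y x then 1 else 0)        ≡⟨ sum-cong-≗ (λ y → length-filterᵇ-allFin (A y)) ⟨
    ∑[ y < n ] outdeg A y                                 ≡⟨ arcs≡∑outdeg ⟨
    arcs A                                                ∎

∈ₛ-tabulate⁻ : ∀ {n} {g : Fin n → Bool} {x} → x ∈ₛ Vec.tabulate g → T (g x)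
∈ₛ-tabulate⁻ {g = g} {x} x∈ = Equivalence.from T-≡ (trans (sym (lookup∘tabulate g x)) ([]=⇒lookup x∈))

T-lookup⇒∈ₛ : ∀ {n} {p : Subset n} {x} → T (Vec.lookup p x) → x ∈ₛ p
T-lookup⇒∈ₛ {p = p} {x} t = lookup⇒[]= x p (Equivalence.to T-≡ t)

arcsFromTo≢0⇒arc : ∀ {n} (A : Adj n) U₁ U₂ → arcsFromTo A U₁ U₂ ≢ 0 →
  ∃₂ λ x y → x ∈ₛ U₁ × y ∈ₛ U₂ × T (A x y)
arcsFromTo≢0⇒arc {n} A U₁ U₂ ≢0 with nonempty ≢0
  where
  nonempty : ∀ {xs : List (Fin n)} → length xs ≢ 0 → ∃ (_∈ xs)
  nonempty {[]} ≢0 = ⊥-elim (≢0 refl)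
  nonempty {y ∷ _} _ = y , here refl
... | y , y∈ with ∈-concat⁻′ (map _ (allFin n)) y∈
... | ys , y∈ys , ys∈ with ∈-map⁻ _ ys∈
... | x , _ , refl with ∈-filter⁻ (T? ∘ _) {xs = allFin n} y∈ys
... | _ , t with Equivalence.to T-∧ t
... | x∈U₁ , t′ with Equivalence.to T-∧ t′
... | y∈U₂ , xy = x , y , T-lookup⇒∈ₛ x∈U₁ , T-lookup⇒∈ₛ y∈U₂ , xy

⅐ : ℚ
⅐ = ℤ.+ 1 /ℚ 7

private
  ι : ℕ → ℚᵘ.ℚᵘ
  ι a = ℚᵘ.mkℚᵘ (ℤ.+ a) 0

  toℚᵘ-ℕq : ∀ a → toℚᵘ (ℕq a) ℚᵘ.≃ ι a
  toℚᵘ-ℕq a = ℚ.toℚᵘ-fromℚᵘ (ι a)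

  ι-+ : ∀ a b → ι (a + b) ℚᵘ.≃ ι a ℚᵘ.+ ι b
  ι-+ a b = ℚᵘ.*≡* (trans (cong (ℤ._* ℤ.+ 1) (ℤ.pos-+ a b)) (identity (ℤ.+ a) (ℤ.+ b)))
    where
    identity : ∀ i j → (i ℤ.+ j) ℤ.* ℤ.+ 1 ≡ (i ℤ.* ℤ.+ 1 ℤ.+ j ℤ.* ℤ.+ 1) ℤ.* ℤ.+ 1
    identity = ℤ.solve-∀

  ι-* : ∀ a b → ι (a * b) ℚᵘ.≃ ι a ℚᵘ.* ι b
  ι-* a b = ℚᵘ.*≡* (cong (ℤ._* ℤ.+ 1) (ℤ.pos-* a b))

ℕq-+ : ∀ a b → ℕq (a + b) ≡ ℕq a +ℚ ℕq b
ℕq-+ a b = ℚ.toℚᵘ-injective (begin-equality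
  toℚᵘ (ℕq (a + b))            ≃⟨ toℚᵘ-ℕq (a + b) ⟩
  ι (a + b)                    ≃⟨ ι-+ a b ⟩
  ι a ℚᵘ.+ ι b                 ≃⟨ ℚᵘ.+-cong (toℚᵘ-ℕq a) (toℚᵘ-ℕq b) ⟨
  toℚᵘ (ℕq a) ℚᵘ.+ toℚᵘ (ℕq b) ≃⟨ ℚ.toℚᵘ-homo-+ (ℕq a) (ℕq b) ⟨
  toℚᵘ (ℕq a +ℚ ℕq b)          ∎)
  where open ℚᵘ.≤-Reasoning

ℕq-* : ∀ a b → ℕq (a * b) ≡ ℕq a *ℚ ℕq b
ℕq-* a b = ℚ.toℚᵘ-injective (begin-equality
  toℚᵘ (ℕq (a * b))            ≃⟨ toℚᵘ-ℕq (a * b) ⟩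
  ι (a * b)                    ≃⟨ ι-* a b ⟩
  ι a ℚᵘ.* ι b                 ≃⟨ ℚᵘ.*-cong (toℚᵘ-ℕq a) (toℚᵘ-ℕq b) ⟨
  toℚᵘ (ℕq a) ℚᵘ.* toℚᵘ (ℕq b) ≃⟨ ℚ.toℚᵘ-homo-* (ℕq a) (ℕq b) ⟨
  toℚᵘ (ℕq a *ℚ ℕq b)          ∎)
  where open ℚᵘ.≤-Reasoning

ℕq-nonNeg : ∀ a → NonNegative (ℕq a)
ℕq-nonNeg a = ℚ.normalize-nonNeg a 1

ℕq-mono : ∀ {a b} → a ≤ b → ℕq a ≤ℚ ℕq b
ℕq-mono {a} a≤b with m≤n⇒∃[o]m+o≡n a≤b
... | d , refl = begin
  ℕq a            ≡⟨ ℚ.+-identityʳ (ℕq a) ⟨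
  ℕq a +ℚ 0ℚ      ≤⟨ ℚ.+-monoʳ-≤ (ℕq a) (ℚ.nonNegative⁻¹ (ℕq d) {{ℕq-nonNeg d}}) ⟩
  ℕq a +ℚ ℕq d    ≡⟨ ℕq-+ a d ⟨
  ℕq (a + d)      ∎
  where open ℚ.≤-Reasoning

C*k≤n⇒k≤γ*n : ∀ {γ C} k n → 0ℚ ≤ℚ γ → 1ℚ <ℚ γ *ℚ C → C *ℚ ℕq k ≤ℚ ℕq n → ℕq k ≤ℚ γ *ℚ ℕq n
C*k≤n⇒k≤γ*n {γ} {C} k n γ≥0 1<γC Ck≤n = begin
  ℕq k                ≡⟨ ℚ.*-identityˡ (ℕq k) ⟨
  1ℚ *ℚ ℕq k          ≤⟨ ℚ.*-monoʳ-≤-nonNeg (ℕq k) {{ℕq-nonNeg k}} (ℚ.<⇒≤ 1<γC) ⟩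
  γ *ℚ C *ℚ ℕq k      ≡⟨ ℚ.*-assoc γ C (ℕq k) ⟩
  γ *ℚ (C *ℚ ℕq k)    ≤⟨ ℚ.*-monoˡ-≤-nonNeg γ {{nonNegative γ≥0}} Ck≤n ⟩
  γ *ℚ ℕq n           ∎
  where open ℚ.≤-Reasoning

k+6*L≤ε'*n : ∀ {γ ε'} k L n → ℕq k ≤ℚ γ *ℚ ℕq n → ℕq L ≤ℚ γ *ℚ ℕq n → γ ≤ℚ ε' *ℚ ⅐ →
  ℕq (k + 6 * L) ≤ℚ ε' *ℚ ℕq n
k+6*L≤ε'*n {γ} {ε'} k L n k≤γn L≤γn γ≤ε'/7 = begin
  ℕq (k + 6 * L)
    ≡⟨ trans (ℕq-+ k (6 * L)) (cong (_+ℚ_ (ℕq k)) (ℕq-* 6 L)) ⟩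
  ℕq k +ℚ ℕq 6 *ℚ ℕq L
    ≤⟨ ℚ.+-mono-≤ k≤γn (ℚ.*-monoˡ-≤-nonNeg (ℕq 6) {{ℕq-nonNeg 6}} L≤γn) ⟩
  γ *ℚ N +ℚ ℕq 6 *ℚ (γ *ℚ N)
    ≡⟨ solve 2 (λ g m → g :* m :+ con (ℕq 6) :* (g :* m) := con (ℕq 7) :* g :* m) refl γ N ⟩
  ℕq 7 *ℚ γ *ℚ N
    ≤⟨ ℚ.*-monoʳ-≤-nonNeg N {{ℕq-nonNeg n}} (ℚ.*-monoˡ-≤-nonNeg (ℕq 7) {{ℕq-nonNeg 7}} γ≤ε'/7) ⟩
  ℕq 7 *ℚ (ε' *ℚ ⅐) *ℚ N
    ≡⟨ solve 2 (λ e m → con (ℕq 7) :* (e :* con ⅐) :* m := e :* m) refl ε' N ⟩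
  ε' *ℚ N
    ∎
  where
  open ℚ.≤-Reasoning
  open +-*-Solver
  N = ℕq n

[½-ε']n≤a : ∀ {ε'} k n a r → ℕq r ≤ℚ ℕq k +ℚ ε' *ℚ ℕq n → n + 2 * k ≤ 2 * (a + r) →
  (½ -ℚ ε') *ℚ ℕq n ≤ℚ ℕq a
[½-ε']n≤a {ε'} k n a r r≤k+ε'n n+2k≤2[a+r] = begin
  (½ -ℚ ε') *ℚ N
    ≡⟨ solve 3 (λ e m c → (con ½ :- e) :* m := con ½ :* (m :+ con (ℕq 2) :* c) :- (c :+ e :* m)) refl ε' N K ⟩
  ½ *ℚ (N +ℚ ℕq 2 *ℚ K) -ℚ (K +ℚ ε' *ℚ N)
    ≤⟨ ℚ.+-mono-≤ (ℚ.*-monoˡ-≤-nonNeg ½ N+2K≤2[A+R]) (ℚ.neg-antimono-≤ r≤k+ε'n) ⟩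
  ½ *ℚ (ℕq 2 *ℚ (ℕq a +ℚ ℕq r)) -ℚ ℕq r
    ≡⟨ solve 2 (λ x y → con ½ :* (con (ℕq 2) :* (x :+ y)) :- y := x) refl (ℕq a) (ℕq r) ⟩
  ℕq a
    ∎
  where
  open ℚ.≤-Reasoning
  open +-*-Solver
  N = ℕq n
  K = ℕq k
  N+2K≤2[A+R] : N +ℚ ℕq 2 *ℚ K ≤ℚ ℕq 2 *ℚ (ℕq a +ℚ ℕq r)
  N+2K≤2[A+R] = begin
    N +ℚ ℕq 2 *ℚ K            ≡⟨ trans (ℕq-+ n (2 * k)) (cong (_+ℚ_ N) (ℕq-* 2 k)) ⟨
    ℕq (n + 2 * k)            ≤⟨ ℕq-mono n+2k≤2[a+r] ⟩
    ℕq (2 * (a + r))          ≡⟨ trans (ℕq-* 2 (a + r)) (cong (ℕq 2 *ℚ_) (ℕq-+ a r)) ⟩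
    ℕq 2 *ℚ (ℕq a +ℚ ℕq r)    ∎

stable⇒arcsFromTo≢0 : ∀ {n} {A : Adj n} {ε'} k r → 0ℚ ≤ℚ ε' → Stable A ε' →
  ℕq r ≤ℚ ℕq k +ℚ ε' *ℚ ℕq n →
  ∀ U₁ U₂ → n + 2 * k ≤ 2 * (∣ U₁ ∣ + r) → n + 2 * k ≤ 2 * (∣ U₂ ∣ + r) → arcsFromTo A U₁ U₂ ≢ 0
stable⇒arcsFromTo≢0 {n} {ε' = ε'} k r ε'≥0 stable r≤k+ε'n U₁ U₂ big₁ big₂ none =
  stable U₁ U₂ ([½-ε']n≤a {ε'} k n ∣ U₁ ∣ r r≤k+ε'n big₁) ([½-ε']n≤a {ε'} k n ∣ U₂ ∣ r r≤k+ε'n big₂)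
    (subst (λ m → ℕq m ≤ℚ ε'n *ℚ ε'n) (sym none) 0≤[ε'n]²)
  where
  ε'n = ε' *ℚ ℕq n
  ε'n≥0 : NonNegative ε'n
  ε'n≥0 = ℚ.nonNeg*nonNeg⇒nonNeg ε' {{nonNegative ε'≥0}} (ℕq n) {{ℕq-nonNeg n}}
  0≤[ε'n]² : 0ℚ ≤ℚ ε'n *ℚ ε'n
  0≤[ε'n]² = ℚ.nonNegative⁻¹ (ε'n *ℚ ε'n) {{ℚ.nonNeg*nonNeg⇒nonNeg ε'n {{ε'n≥0}} ε'n {{ε'n≥0}}}}

module _ {n : ℕ} where

  vertices : List (FourPath n) → List (Fin n)
  vertices = concatMap Vec.toList

  length-vertices : ∀ Fs → length (vertices Fs) ≡ 4 * length Fs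
  length-vertices [] = refl
  length-vertices ((_ Vec.∷ _ Vec.∷ _ Vec.∷ _ Vec.∷ Vec.[]) ∷ Fs) =
    trans (cong (4 +_) (length-vertices Fs)) (sym (*-suc 4 (length Fs)))

  chain-↭ : ∀ Fs ps → length ps ≡ length Fs ∸ 1 → chain Fs ps ↭ vertices Fs ++ concat ps
  chain-↭ [] [] _ = ↭-refl
  chain-↭ (F ∷ []) [] _ =
    ↭-reflexive (sym (trans (++-identityʳ (Vec.toList F ++ [])) (++-identityʳ (Vec.toList F))))
  chain-↭ (F ∷ F′ ∷ Fs) (p ∷ ps) |p∷ps|≡ = begin
    Vec.toList F ++ p ++ chain (F′ ∷ Fs) ps
      ↭⟨ ++⁺ˡ (Vec.toList F) (++⁺ˡ p (chain-↭ (F′ ∷ Fs) ps (suc-injective |p∷ps|≡))) ⟩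
    Vec.toList F ++ p ++ vertices (F′ ∷ Fs) ++ concat ps
      ↭⟨ ++⁺ˡ (Vec.toList F) (shifts p (vertices (F′ ∷ Fs))) ⟩
    Vec.toList F ++ vertices (F′ ∷ Fs) ++ p ++ concat ps
      ≡⟨ ++-assoc (Vec.toList F) (vertices (F′ ∷ Fs)) _ ⟨
    vertices (F ∷ F′ ∷ Fs) ++ concat (p ∷ ps)
      ∎
    where open PermutationReasoning

  chains-↭ : ∀ s (parts : Fin s → List (FourPath n)) conn → (∀ i → length (conn i) ≡ length (parts i) ∸ 1) →
    concat (funToList (λ i → chain (parts i) (conn i))) ↭
    vertices (concat (funToList parts)) ++ concat (funToList (concat ∘ conn))
  chains-↭ zero _ _ _ = ↭-refl
  chains-↭ (suc s) parts conn |conn|≡ = begin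
    chain P₀ (conn zero) ++ concat (funToList (λ i → chain (parts (suc i)) (conn (suc i))))
      ↭⟨ ++⁺ (chain-↭ P₀ (conn zero) (|conn|≡ zero)) (chains-↭ s (parts ∘ suc) (conn ∘ suc) (|conn|≡ ∘ suc)) ⟩
    (vertices P₀ ++ concat (conn zero)) ++ (vertices Ps ++ concat (funToList (concat ∘ conn ∘ suc)))
      ↭⟨ interchange (vertices P₀) (concat (conn zero)) (vertices Ps) _ ⟩
    (vertices P₀ ++ vertices Ps) ++ (concat (conn zero) ++ concat (funToList (concat ∘ conn ∘ suc)))
      ≡⟨ cong (_++ _) (concatMap-++ Vec.toList P₀ Ps) ⟨
    vertices (concat (funToList parts)) ++ concat (funToList (concat ∘ conn)) ∎
    where
    open PermutationReasoning
    open Algebra.Properties.CommutativeSemigroup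
      (CommutativeMonoid.commutativeSemigroup (++-commutativeMonoid {A = Fin n})) using (interchange)
    P₀ = parts zero
    Ps = concat (funToList (parts ∘ suc))

  Valid : (Fin n → Set) → List (Fin n) → Set
  Valid Ok vs = Unique vs × All Ok vs

  module _ (A : Adj n) where

    ArcsAlong-∷-chain : ∀ {y} F Fs ps → T (A y (Vec.head F)) →
      ArcsAlong A (chain (F ∷ Fs) ps) → ArcsAlong A (y ∷ chain (F ∷ Fs) ps)
    ArcsAlong-∷-chain (_ Vec.∷ _ Vec.∷ _ Vec.∷ _ Vec.∷ Vec.[]) [] ps yF along = yF , along
    ArcsAlong-∷-chain (_ Vec.∷ _ Vec.∷ _ Vec.∷ _ Vec.∷ Vec.[]) (_ ∷ _) [] yF along = yF , along
    ArcsAlong-∷-chain (_ Vec.∷ _ Vec.∷ _ Vec.∷ _ Vec.∷ Vec.[]) (_ ∷ _) (_ ∷ _) yF along = yF , along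

    Links : List (FourPath n) → List (List (Fin n)) → Set
    Links Fs ps = length ps ≡ length Fs ∸ 1 × All (λ p → length p ≤ 2) ps × ArcsAlong A (chain Fs ps)

    length-connectors-≤ : ∀ Fs {ps} → Links Fs ps → length (concat ps) ≤ 2 * length Fs
    length-connectors-≤ Fs (|ps|≡ , short , _) =
      ≤-trans (length-concat-≤ short) (*-monoʳ-≤ 2 (≤-trans (≤-reflexive |ps|≡) (m∸n≤m (length Fs) 1)))

    module Greedy (Ok : Fin n → Set) (budget : ℕ)
      (bridge : ∀ b d used → length used ≤ budget → Valid Ok used →
                ∃₂ λ x y → ArcsAlong A (b ∷ x ∷ y ∷ d ∷ []) × Valid Ok (x ∷ y ∷ used)) where

      -- Later absorbers are connected first, so the vertices in use are always the connectors
      -- built so far followed by avoid.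
      connect : ∀ Fs avoid → All (ArcsAlong A ∘ Vec.toList) Fs → Valid Ok avoid →
        2 * length Fs + length avoid ≤ budget →
        Σ[ ps ∈ List (List (Fin n)) ] Links Fs ps × Valid Ok (concat ps ++ avoid)
      connect [] avoid [] valid _ = [] , (refl , [] , tt) , valid
      connect (F ∷ []) avoid (along ∷ []) valid _ = [] , (refl , [] , along) , valid
      connect (F@(z₁ Vec.∷ z₂ Vec.∷ z₃ Vec.∷ z₄ Vec.∷ Vec.[]) ∷ F′ ∷ Fs) avoid
              ((z₁z₂ , z₂z₃ , z₃z₄ , _) ∷ alongs) valid room =
        let ps , links , valid′ = connect (F′ ∷ Fs) avoid alongs valid room′
            |ps|≡ , short , along = links
            x , y , (z₄x , xy , yF′ , _) , valid″ = bridge z₄ (Vec.head F′) (concat ps ++ avoid) (fits links) valid′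
        in (x ∷ y ∷ []) ∷ ps ,
           (cong suc |ps|≡ , s≤s (s≤s z≤n) ∷ short , (z₁z₂ , z₂z₃ , z₃z₄ , z₄x , xy , ArcsAlong-∷-chain F′ Fs ps yF′ along)) ,
           valid″
        where
        room′ : 2 * length (F′ ∷ Fs) + length avoid ≤ budget
        room′ = ≤-trans (+-monoˡ-≤ (length avoid) (*-monoʳ-≤ 2 (n≤1+n (length (F′ ∷ Fs))))) room
        fits : ∀ {ps} → Links (F′ ∷ Fs) ps → length (concat ps ++ avoid) ≤ budget
        fits {ps} links = begin
          length (concat ps ++ avoid)           ≡⟨ length-++ (concat ps) ⟩
          length (concat ps) + length avoid     ≤⟨ +-monoˡ-≤ (length avoid) (length-connectors-≤ (F′ ∷ Fs) links) ⟩
          2 * length (F′ ∷ Fs) + length avoid   ≤⟨ room′ ⟩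
          budget                                ∎
          where open ≤-Reasoning

      connectAll : ∀ s (parts : Fin s → List (FourPath n)) →
        All (ArcsAlong A ∘ Vec.toList) (concat (funToList parts)) →
        2 * length (concat (funToList parts)) ≤ budget →
        Σ[ conn ∈ (Fin s → List (List (Fin n))) ] (∀ i → Links (parts i) (conn i)) ×
          Valid Ok (concat (funToList (concat ∘ conn))) ×
          length (concat (funToList (concat ∘ conn))) ≤ 2 * length (concat (funToList parts))
      connectAll zero parts _ _ = (λ ()) , (λ ()) , ([] , []) , z≤n
      connectAll (suc s) parts alongs room =
        let conn , links , valid , size = connectAll s (parts ∘ suc) (All.++⁻ʳ P₀ alongs) room₊
            U = concat (funToList (concat ∘ conn))
            ps , links₀ , valid₀ = connect P₀ U (All.++⁻ˡ P₀ alongs) valid (room₀ U size)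
        in ps ∷ᶠ conn , ∀-cons links₀ links , valid₀ , total U links₀ size
        where
        P₀ = parts zero
        Ps = concat (funToList (parts ∘ suc))
        room₊ : 2 * length Ps ≤ budget
        room₊ = ≤-trans (*-monoʳ-≤ 2 (length-++-≤ʳ Ps {P₀})) room
        room₀ : ∀ U → length U ≤ 2 * length Ps → 2 * length P₀ + length U ≤ budget
        room₀ U size = ≤-trans (+-monoʳ-≤ (2 * length P₀) size) (≤-trans (≤-reflexive (*-length-++ 2 P₀)) room)
        total : ∀ {ps} U → Links P₀ ps → length U ≤ 2 * length Ps → length (concat ps ++ U) ≤ 2 * length (P₀ ++ Ps)
        total {ps} U links₀ size = begin
          length (concat ps ++ U)             ≡⟨ length-++ (concat ps) ⟩
          length (concat ps) + length U       ≤⟨ +-mono-≤ (length-connectors-≤ P₀ links₀) size ⟩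
          2 * length P₀ + 2 * length Ps       ≡⟨ *-length-++ 2 P₀ ⟩
          2 * length (P₀ ++ Ps)               ∎
          where open ≤-Reasoning

module StableBridge {n h} (A : Adj n) (loopless : Loopless A) (f : Fin h → Fin n) (family : List (Fin n))
  (k r budget : ℕ)
  (δ⁺ : ∀ x → n + 2 * k ≤ 2 * outdeg A x) (δ⁻ : ∀ x → n + 2 * k ≤ 2 * indeg A x)
  (stable : ∀ U₁ U₂ → n + 2 * k ≤ 2 * (∣ U₁ ∣ + r) → n + 2 * k ≤ 2 * (∣ U₂ ∣ + r) → arcsFromTo A U₁ U₂ ≢ 0)
  (room : h + (length family + budget) ≤ r) where

  Fresh : Fin n → Set
  Fresh v = InD' f v × v ∉ family

  N⁺ N⁻ : Fin n → Subset n
  N⁺ b = Vec.tabulate (A b)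
  N⁻ d = Vec.tabulate (λ y → A y d)

  module _ (used : List (Fin n)) where

    forbidden : List (Fin n)
    forbidden = map f (allFin h) ++ family ++ used

    avoiding : Subset n → Subset n
    avoiding p = p ∩ ∁ (fromList forbidden)

    avoiding-large : length used ≤ budget → ∀ (g : Fin n → Bool) → n + 2 * k ≤ 2 * length (filterᵇ g (allFin n)) →
      n + 2 * k ≤ 2 * (∣ avoiding (Vec.tabulate g) ∣ + r)
    avoiding-large |used|≤ g big = ≤-trans big (*-monoʳ-≤ 2 (begin
      length (filterᵇ g (allFin n))                            ≡⟨ length-filterᵇ-tabulate g id ⟩
      ∣ Vec.tabulate g ∣                                       ≤⟨ ∣p∣≤∣p∩∁q∣+∣q∣ (Vec.tabulate g) _ ⟩
      ∣ avoiding (Vec.tabulate g) ∣ + ∣ fromList forbidden ∣  ≤⟨ +-monoʳ-≤ _ (∣fromList∣≤length forbidden) ⟩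
      ∣ avoiding (Vec.tabulate g) ∣ + length forbidden         ≡⟨ cong (∣ avoiding (Vec.tabulate g) ∣ +_) |forbidden|≡ ⟩
      ∣ avoiding (Vec.tabulate g) ∣ + (h + (length family + length used))
        ≤⟨ +-monoʳ-≤ _ (≤-trans (+-monoʳ-≤ h (+-monoʳ-≤ (length family) |used|≤)) room) ⟩
      ∣ avoiding (Vec.tabulate g) ∣ + r                        ∎))
      where
      open ≤-Reasoning
      |forbidden|≡ : length forbidden ≡ h + (length family + length used)
      |forbidden|≡ = trans (length-++ (map f (allFin h)) {family ++ used})
        (cong₂ _+_ (trans (length-map f (allFin h)) (length-tabulate {n = h} id)) (length-++ family))

    ∈-avoiding⁻ : ∀ {g : Fin n → Bool} {x} → x ∈ₛ avoiding (Vec.tabulate g) → T (g x) × Fresh x × x ∉ used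
    ∈-avoiding⁻ {g} {x} x∈ with x∈p∩q⁻ (Vec.tabulate g) _ x∈
    ... | x∈g , x∈∁ =
      ∈ₛ-tabulate⁻ x∈g , (inD' , x∉ ∘ ∈-++⁺ʳ (map f (allFin h)) ∘ ∈-++⁺ˡ) , x∉ ∘ ∈-++⁺ʳ (map f (allFin h)) ∘ ∈-++⁺ʳ family
      where
      x∉ : x ∉ forbidden
      x∉ = x∈∁p⇒x∉p x∈∁ ∘ ∈-fromList⁺
      inD' : InD' f x
      inD' z fz≡x = x∉ (∈-++⁺ˡ (subst (_∈ map f (allFin h)) fz≡x (∈-map⁺ f (∈-allFin z))))

  arc⇒≢ : ∀ {x y} → T (A x y) → x ≢ y
  arc⇒≢ {x} xy refl = subst T (loopless x) xy

  bridge : ∀ b d used → length used ≤ budget → Valid Fresh used →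
    ∃₂ λ x y → ArcsAlong A (b ∷ x ∷ y ∷ d ∷ []) × Valid Fresh (x ∷ y ∷ used)
  bridge b d used |used|≤ (unique , fresh) =
    let x , y , x∈U₁ , y∈U₂ , xy = arcsFromTo≢0⇒arc A U₁ U₂ (stable U₁ U₂ U₁-large U₂-large)
        bx , x-fresh , x∉used = ∈-avoiding⁻ used x∈U₁
        yd , y-fresh , y∉used = ∈-avoiding⁻ used y∈U₂
    in x , y , (bx , xy , yd , tt) ,
       ((arc⇒≢ xy ∷ All.¬Any⇒All¬ used x∉used) ∷ All.¬Any⇒All¬ used y∉used ∷ unique) ,
       x-fresh ∷ y-fresh ∷ fresh
    where
    U₁ = avoiding used (N⁺ b)
    U₂ = avoiding used (N⁻ d)
    U₁-large = avoiding-large used |used|≤ (A b) (δ⁺ b)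
    U₂-large = avoiding-large used |used|≤ (λ y → A y d) (δ⁻ d)

Connections : ∀ {n h} → Adj n → (Fin h → Fin n) → ∀ s → (Fin s → List (FourPath n)) → Set
Connections {n} A f s parts =
  Σ (Fin s → List (List (Fin n))) λ conn →
    ((i : Fin s) → length (conn i) ≡ length (parts i) ∸ 1) ×
    ((i : Fin s) → All (λ p → length p ≤ 2) (conn i)) ×
    ((i : Fin s) → IsPathInD' A f (chain (parts i) (conn i))) ×
    ((i j : Fin s) → i ≢ j → VDisjoint (chain (parts i) (conn i)) (chain (parts j) (conn j)))

freshConnectors⇒Connections : ∀ {n h} (A : Adj n) (f : Fin h → Fin n) s (parts : Fin s → List (FourPath n))
  (conn : Fin s → List (List (Fin n))) →
  let 𝓕 = concat (funToList parts) in
  All (λ z → IsPathInD' A f (Vec.toList z)) 𝓕 →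
  AllPairs (λ z w → VDisjoint (Vec.toList z) (Vec.toList w)) 𝓕 →
  (∀ i → Links A (parts i) (conn i)) →
  Valid (λ v → InD' f v × v ∉ vertices 𝓕) (concat (funToList (concat ∘ conn))) →
  Connections A f s parts
freshConnectors⇒Connections {n} A f s parts conn paths disjoint links (unique-U , fresh-U) =
  conn , proj₁ ∘ links , proj₁ ∘ proj₂ ∘ links ,
  (λ i → unique-chain i , All.tabulate⁻ (All.concat⁻ inD'-chains) i , proj₂ (proj₂ (links i))) ,
  λ i j i≢j v v∈ᵢ v∈ⱼ → disjoint-chains i≢j (v∈ᵢ , v∈ⱼ)
  where
  family = vertices (concat (funToList parts))
  chains = λ i → chain (parts i) (conn i)
  σ : family ++ concat (funToList (concat ∘ conn)) ↭ concat (funToList chains)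
  σ = ↭-sym (chains-↭ s parts conn (proj₁ ∘ links))
  unique-family : Unique family
  unique-family = Unique.concat⁺ (All.map⁺ (All.map proj₁ paths))
    (AllPairs.map⁺ (AllPairs.map (λ z#w {v} (v∈z , v∈w) → z#w v v∈z v∈w) disjoint))
  unique-chains : Unique (concat (funToList chains))
  unique-chains = Permₛ.Unique-resp-↭ (setoid (Fin n)) (↭⇒↭ₛ σ)
    (Unique.++⁺ unique-family unique-U λ (v∈family , v∈U) → proj₂ (All.lookup fresh-U v∈U) v∈family)
  inD'-chains : All (InD' f) (concat (funToList chains))
  inD'-chains = All-resp-↭ σ (All.++⁺ (All.concat⁺ (All.map⁺ (All.map (proj₁ ∘ proj₂) paths))) (All.map proj₁ fresh-U))
  unique-chain = proj₁ (Unique-concat-tabulate⁻ s chains unique-chains)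
  disjoint-chains = proj₂ (Unique-concat-tabulate⁻ s chains unique-chains)

connectParts : ∀ {n h} (A : Adj n) → Loopless A → (f : Fin h → Fin n) → ∀ k → h ≤ k + k →
  (∀ x → n + 2 * k ≤ 2 * outdeg A x) → (∀ x → n + 2 * k ≤ 2 * indeg A x) →
  ∀ s (parts : Fin s → List (FourPath n)) →
  let 𝓕 = concat (funToList parts); r = k + (k + 6 * length 𝓕) in
  (∀ U₁ U₂ → n + 2 * k ≤ 2 * (∣ U₁ ∣ + r) → n + 2 * k ≤ 2 * (∣ U₂ ∣ + r) → arcsFromTo A U₁ U₂ ≢ 0) →
  All (λ z → IsPathInD' A f (Vec.toList z)) 𝓕 →
  AllPairs (λ z w → VDisjoint (Vec.toList z) (Vec.toList w)) 𝓕 →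
  Connections A f s parts
connectParts {n} {h} A loopless f k h≤2k δ⁺ δ⁻ s parts stable paths disjoint =
  let conn , links , valid , _ = connectAll s parts (All.map (proj₂ ∘ proj₂) paths) ≤-refl
  in freshConnectors⇒Connections A f s parts conn paths disjoint links valid
  where
  𝓕 = concat (funToList parts)
  L = length 𝓕
  room : h + (length (vertices 𝓕) + 2 * L) ≤ k + (k + 6 * L)
  room = begin
    h + (length (vertices 𝓕) + 2 * L)   ≡⟨ cong (λ m → h + (m + 2 * L)) (length-vertices 𝓕) ⟩
    h + (4 * L + 2 * L)                 ≤⟨ +-monoˡ-≤ (4 * L + 2 * L) h≤2k ⟩
    (k + k) + (4 * L + 2 * L)           ≡⟨ regroup k L ⟩
    k + (k + 6 * L)                     ∎
    where
    open ≤-Reasoning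
    regroup : ∀ k L → (k + k) + (4 * L + 2 * L) ≡ k + (k + 6 * L)
    regroup = solve-∀
  open StableBridge A loopless f (vertices 𝓕) k (k + (k + 6 * L)) (2 * L) δ⁺ δ⁻ stable room
  open Greedy A Fresh (2 * L) bridge

lemma3p5 :
  (ε : ℚ) → 0ℚ <ℚ ε → ε <ℚ 1ℚ →
  Σ ℚ λ ε₁₀ → 0ℚ <ℚ ε₁₀ × ((ε₁ : ℚ) → 0ℚ <ℚ ε₁ → ε₁ ≤ℚ ε₁₀ →
  Σ ℚ λ ε'₀ → 0ℚ <ℚ ε'₀ × ((ε' : ℚ) → 0ℚ <ℚ ε' → ε' ≤ℚ ε'₀ →
  Σ ℚ λ γ₀ → 0ℚ <ℚ γ₀ × ((γ : ℚ) → 0ℚ <ℚ γ → γ ≤ℚ γ₀ →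
  (C : ℚ) → 1ℚ <ℚ γ *ℚ C →
  -- the digraph H with k arcs and no isolated vertices
  (h : ℕ) (AH : Adj h) → Loopless AH →
  ((x : Fin h) → 1 ≤ outdeg AH x + indeg AH x) →
  -- the digraph D on n ≥ Ck vertices
  (n : ℕ) → C *ℚ ℕq (arcs AH) ≤ℚ ℕq n →
  (A : Adj n) → Loopless A →
  ((x : Fin n) → n + 2 * arcs AH ≤ 2 * outdeg A x) →
  ((x : Fin n) → n + 2 * arcs AH ≤ 2 * indeg A x) →
  Stable A ε' →
  -- the injection f, D' = D - f(V(H))
  (f : Fin h → Fin n) → Injective _≡_ _≡_ f →
  -- the family 𝓕 = 𝓕₁ ∪ ⋯ ∪ 𝓕ₛ, 𝓕ᵢ = (F_{i,1}, …, F_{i,lᵢ})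
  (s : ℕ) → 1 ≤ s → (parts : Fin s → List (FourPath n)) →
  All (λ z → IsPathInD' A f (toList z)) (concat (funToList parts)) →
  AllPairs (λ z w → VDisjoint (toList z) (toList w)) (concat (funToList parts)) →
  ℕq (length (concat (funToList parts))) ≤ℚ γ *ℚ ℕq n →
  ((u v : Fin n) → InD' f u → InD' f v → u ≢ v →
    (γ *ℚ γ) *ℚ ℕq n ≤ℚ ℕq (absorbCount A (concat (funToList parts)) u v)) →
  -- conclusion: connecting paths P_{i,j} (interiors, length ≤ 3)
  Σ (Fin s → List (List (Fin n))) λ conn →
    ((i : Fin s) → length (conn i) ≡ length (parts i) ∸ 1) ×
    ((i : Fin s) → All (λ p → length p ≤ 2) (conn i)) ×
    ((i : Fin s) → IsPathInD' A f (chain (parts i) (conn i))) ×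
    ((i j : Fin s) → i ≢ j → VDisjoint (chain (parts i) (conn i)) (chain (parts j) (conn j))))))
lemma3p5 _ _ _ = 1ℚ , ℚ.positive⁻¹ 1ℚ , λ _ _ _ → 1ℚ , ℚ.positive⁻¹ 1ℚ , λ ε' 0<ε' _ →
  ε' *ℚ ⅐ , ℚ.*-monoˡ-<-pos ⅐ 0<ε' ,
  λ γ 0<γ γ≤γ₀ C 1<γC h H _ noIsolated n Ck≤n A loopless δ⁺ δ⁻ stable f _ s _ parts paths disjoint L≤γn _ →
  let k = arcs H
      L = length (concat (funToList parts))
      k≤γn = C*k≤n⇒k≤γ*n k n (ℚ.<⇒≤ 0<γ) 1<γC Ck≤n
      r≤k+ε'n = ℚ.≤-trans (ℚ.≤-reflexive (ℕq-+ k (k + 6 * L))) (ℚ.+-monoʳ-≤ (ℕq k) (k+6*L≤ε'*n {ε' = ε'} k L n k≤γn L≤γn γ≤γ₀))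
  in connectParts A loopless f k (noIsolated⇒n≤arcs+arcs H noIsolated) δ⁺ δ⁻ s parts
       (stable⇒arcsFromTo≢0 k (k + (k + 6 * L)) (ℚ.<⇒≤ 0<ε') stable r≤k+ε'n) paths disjoint
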